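{- Let $n,k\ge1$. The graph $nK_2$ admits a $k$-super graceful labeling in which the $n$ largest labels $k+2n,\dots,k+3n-1$ are assigned to $n$ mutually non-adjacent vertices if and only if $n=2k-1$. Moreover, $(2k-1)K_2$ admits a $k$-super graceful labeling whose edge-label set is $[k,3k-2]$.
   Context: $nK_2$ denotes the disjoint union of $n$ copies of $K_2$. For integers $a\le b$, $[a,b]$ is the set of integers between $a$ and $b$ inclusive. For $k\ge 1$, a $k$-super graceful labeling of a graph $G=(V,E)$ with $p$ vertices and $q$ edges is a bijection $f:V\cup E\to[k,k+p+q-1]$ with $f(uv)=|f(u)-f(v)|$ for every edge $uv$. -}

module Defs where

open import Data.Nat using (ℕ; _+_; _*_; _≤_; _<_; ∣_-_∣)
open import Data.Fin using (Fin; _↑ˡ_; _↑ʳ_)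
open import Data.Sum using (_⊎_; inj₁; inj₂)
open import Data.Product using (Σ; ∃; _×_; _,_)
open import Relation.Binary.PropositionalEquality using (_≡_; _≢_)
open import Relation.Nullary using (¬_)

record Graph : Set where
  field
    p   : ℕ
    q   : ℕ
    src : Fin q → Fin p
    tgt : Fin q → Fin p
open Graph public

Elem : Graph → Set
Elem G = Fin (p G) ⊎ Fin (q G)

Adjacent : (G : Graph) → Fin (p G) → Fin (p G) → Set
Adjacent G u v =
  ∃ λ (e : Fin (q G)) →
    (src G e ≡ u × tgt G e ≡ v) ⊎ (src G e ≡ v × tgt G e ≡ u)

-- n K_2 : vertices Fin (n + n); the i-th copy of K_2 is the edge joining
-- vertex i (↑ˡ) and vertex n + i (↑ʳ).
nK₂ : ℕ → Graph
nK₂ n = record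
  { p   = n + n
  ; q   = n
  ; src = λ i → i ↑ˡ n
  ; tgt = λ i → n ↑ʳ i
  }

IsSuperGraceful : ℕ → (G : Graph) → (Elem G → ℕ) → Set
IsSuperGraceful k G f =
    (∀ x y → f x ≡ f y → x ≡ y)
  × (∀ x → k ≤ f x × f x < k + (p G + q G))
  × (∀ m → k ≤ m → m < k + (p G + q G) → ∃ λ x → f x ≡ m)
  × (∀ e → f (inj₂ e) ≡ ∣ f (inj₁ (src G e)) - f (inj₁ (tgt G e)) ∣)

-- The labels in [a, b] (given as a ≤ m < c with c = b + 1) are exactly
-- the labels of n mutually non-adjacent vertices.
LargestOnIndependent : (G : Graph) → (Elem G → ℕ) → (n a c : ℕ) → Set
LargestOnIndependent G f n a c =
  ∃ λ (S : Fin n → Fin (p G)) →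
      (∀ i j → S i ≡ S j → i ≡ j)
    × (∀ i j → i ≢ j → ¬ Adjacent G (S i) (S j))
    × (∀ i → a ≤ f (inj₁ (S i)) × f (inj₁ (S i)) < c)
    × (∀ m → a ≤ m → m < c → ∃ λ i → f (inj₁ (S i)) ≡ m)

module Submission where

-- Necessity is a double count.  The 3n labels are k, …, k + 3n - 1, and on every
-- edge uv we have f(u) + f(v) + f(uv) = 2 max(f(u), f(v)).  An independent set of
-- n vertices meets every edge, so when it carries the labels [k + 2n, k + 3n) each
-- edge maximum is at least k + 2n; the n maxima are distinct, hence are exactly
-- these labels.  Comparing the two Gauss sums gives n(n + 1) = 2kn: n = 2k - 1.
--
-- Sufficiency is an explicit labeling for k = K + 1, n = 2K + 1: edge labels fill
-- [k, 3k - 2], sources the next block and each target is source + edge, which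
-- interleaves the top block.  Only coverage of the label interval is checked:
-- a map from a set of size N onto an interval of length N is a bijection onto it.

open import Defs
open import Data.Nat using (ℕ; zero; suc; _+_; _*_; _∸_; _≤_; _<_; _⊔_; ∣_-_∣; z≤n; s≤s; _<?_; >-nonZero)
open import Data.Nat.Properties
open import Data.Nat.Tactic.RingSolver using (solve-∀)
open import Data.Fin as Fin using (Fin; toℕ; fromℕ<; punchOut; splitAt; join; _↑ˡ_; _↑ʳ_)
open import Data.Fin.Properties
  using (toℕ-injective; toℕ-fromℕ<; toℕ<n; any?; punchOut-injective; injective⇒≤;
         splitAt-↑ˡ; splitAt-↑ʳ; splitAt-join; join-splitAt; ↑ʳ-injective)
open import Data.Fin.Permutation using (permutation)
open import Data.Vec.Functional using (_++_)
open import Data.Vec.Functional.Properties using (lookup-++ˡ; lookup-++ʳ)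
open import Data.Product using (∃; _×_; _,_; proj₁; proj₂)
open import Data.Sum using (_⊎_; inj₁; inj₂; [_,_]′)
open import Data.Sum.Properties using (inj₁-injective)
open import Data.Empty using (⊥-elim)
open import Function using (id; _∘_)
open import Function.Definitions using (Injective)
open import Relation.Nullary using (yes; no; ¬_)
open import Relation.Binary.PropositionalEquality
open import Algebra.Properties.CommutativeMonoid.Sum +-0-commutativeMonoid
  using (sum-syntax; sum-cong-≗; ∑-distrib-+; sum-permute)

Into : {A : Set} → ℕ → ℕ → (A → ℕ) → Set
Into a b h = ∀ x → a ≤ h x × h x < b

Onto : {A : Set} → ℕ → ℕ → (A → ℕ) → Set
Onto {A} a b h = ∀ m → a ≤ m → m < b → ∃ λ (x : A) → h x ≡ m

onto-∪ : ∀ {A : Set} {a b c} {h : A → ℕ} → Onto a b h → Onto b c h → Onto a c h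
onto-∪ {b = b} lower upper m a≤m m<c with m <? b
... | yes m<b = lower m a≤m m<b
... | no m≮b  = upper m (≮⇒≥ m≮b) m<c

onto-∘ : ∀ {A B : Set} {a b} {h : B → ℕ} (φ : A → B) → Onto a b (h ∘ φ) → Onto a b h
onto-∘ φ h∘φ-onto m a≤m m<b with h∘φ-onto m a≤m m<b
... | x , hφx≡m = φ x , hφx≡m

onto-≗ : ∀ {A : Set} {a b} {g h : A → ℕ} → (∀ x → g x ≡ h x) → Onto a b g → Onto a b h
onto-≗ g≗h g-onto m a≤m m<b with g-onto m a≤m m<b
... | x , gx≡m = x , trans (sym (g≗h x)) gx≡m

onto-shift : ∀ {A : Set} {N} c {h : A → ℕ} → Onto 0 N h → Onto c (c + N) (λ x → c + h x)
onto-shift c h-onto m c≤m m<c+N with m≤n⇒∃[o]m+o≡n c≤m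
... | d , refl with h-onto d z≤n (+-cancelˡ-< c d _ m<c+N)
...   | x , hx≡d = x , cong (c +_) hx≡d

toℕ-onto : ∀ {N} → Onto 0 N (toℕ {N})
toℕ-onto m _ m<N = fromℕ< m<N , toℕ-fromℕ< m<N

++-onto-ˡ : ∀ {m n a b} {xs : Fin m → ℕ} (ys : Fin n → ℕ) → Onto a b xs → Onto a b (xs ++ ys)
++-onto-ˡ {n = n} {xs = xs} ys = onto-∘ (_↑ˡ n) ∘ onto-≗ (λ i → sym (lookup-++ˡ xs ys i))

++-onto-ʳ : ∀ {m n a b} (xs : Fin m → ℕ) {ys : Fin n → ℕ} → Onto a b ys → Onto a b (xs ++ ys)
++-onto-ʳ {m} xs {ys} = onto-∘ (m ↑ʳ_) ∘ onto-≗ (λ j → sym (lookup-++ʳ xs ys j))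

-- Pigeonhole: an injective endomap of Fin N hits every element (if it missed
-- j, composing with punchOut j would inject Fin (1 + N) into Fin N).
injective⇒surjective : ∀ {N} (g : Fin N → Fin N) → Injective _≡_ _≡_ g → ∀ j → ∃ λ i → g i ≡ j
injective⇒surjective {suc N} g g-inj j with any? (λ i → g i Fin.≟ j)
... | yes hit = hit
... | no miss = ⊥-elim (<-irrefl refl (injective⇒≤ squeezed-inj))
  where
    avoids : ∀ i → j ≢ g i
    avoids i j≡gi = miss (i , sym j≡gi)
    squeezed : Fin (suc N) → Fin N
    squeezed i = punchOut (avoids i)
    squeezed-inj : Injective _≡_ _≡_ squeezed
    squeezed-inj {x} {y} eq = g-inj (punchOut-injective (avoids x) (avoids y) eq)

∑-reindex : ∀ {N} (t : Fin N → ℕ) (g : Fin N → Fin N) → Injective _≡_ _≡_ g →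
  ∑[ i < N ] t (g i) ≡ ∑[ i < N ] t i
∑-reindex t g g-inj = sym (sum-permute t π)
  where
    g-surj = injective⇒surjective g g-inj
    π = permutation g (λ j → proj₁ (g-surj j)) (λ j → proj₂ (g-surj j))
                      (λ i → g-inj (proj₂ (g-surj (g i))))

gauss : ∀ a N → 2 * ∑[ i < N ] (a + toℕ i) + N ≡ N * (2 * a + N)
gauss a zero = refl
gauss a (suc N) = begin
  2 * (a + 0 + ∑[ i < N ] (a + suc (toℕ i))) + suc N
    ≡⟨ cong (λ s → 2 * (a + 0 + s) + suc N) (sum-cong-≗ {N} (λ i → +-suc a (toℕ i))) ⟩
  2 * (a + 0 + ∑[ i < N ] (suc a + toℕ i)) + suc N
    ≡⟨ peel a N _ ⟩
  (2 * ∑[ i < N ] (suc a + toℕ i) + N) + (2 * a + 1)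
    ≡⟨ cong (_+ (2 * a + 1)) (gauss (suc a) N) ⟩
  N * (2 * suc a + N) + (2 * a + 1)
    ≡⟨ close a N ⟩
  suc N * (2 * a + suc N) ∎
  where
    open ≡-Reasoning
    peel : ∀ a N s → 2 * (a + 0 + s) + suc N ≡ (2 * s + N) + (2 * a + 1)
    peel = solve-∀
    close : ∀ a N → N * (2 * suc a + N) + (2 * a + 1) ≡ suc N * (2 * a + suc N)
    close = solve-∀

-- An injective h : Fin N → [a, a + N) is a + (a permutation of Fin N), so its
-- sum is the Gauss sum.
module InjectiveIntoInterval {N a : ℕ} (h : Fin N → ℕ) (h-into : Into a (a + N) h)
                             (h-inj : Injective _≡_ _≡_ h) where

  offset-bound : ∀ {x} → a ≤ x → x < a + N → x ∸ a < N
  offset-bound {x} a≤x x<a+N = subst (x ∸ a <_) (m+n∸m≡n a N) (∸-monoˡ-< x<a+N a≤x)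

  offset : Fin N → Fin N
  offset i = fromℕ< (offset-bound (proj₁ (h-into i)) (proj₂ (h-into i)))

  offset-spec : ∀ i → a + toℕ (offset i) ≡ h i
  offset-spec i = trans (cong (a +_) (toℕ-fromℕ< _)) (m+[n∸m]≡n (proj₁ (h-into i)))

  offset-injective : Injective _≡_ _≡_ offset
  offset-injective {i} {j} eq =
    h-inj (trans (sym (offset-spec i)) (trans (cong (λ o → a + toℕ o) eq) (offset-spec j)))

  gauss-sum : 2 * ∑[ i < N ] h i + N ≡ N * (2 * a + N)
  gauss-sum = begin
    2 * ∑[ i < N ] h i + N                   ≡⟨ cong (λ s → 2 * s + N) (sum-cong-≗ {N} (λ i → sym (offset-spec i))) ⟩
    2 * ∑[ i < N ] (a + toℕ (offset i)) + N  ≡⟨ cong (λ s → 2 * s + N) (∑-reindex (λ o → a + toℕ o) offset offset-injective) ⟩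
    2 * ∑[ i < N ] (a + toℕ i) + N           ≡⟨ gauss a N ⟩
    N * (2 * a + N)                          ∎
    where open ≡-Reasoning

-- Conversely, if h : Fin N → ℕ covers [a, a + N), then choosing a preimage of
-- each value gives an injective, hence bijective, endomap of Fin N: so h is
-- injective and all its values lie in [a, a + N).
module CoveringInterval {N a : ℕ} (h : Fin N → ℕ) (h-onto : Onto a (a + N) h) where

  hit : ∀ j → ∃ λ x → h x ≡ a + toℕ j
  hit j = h-onto (a + toℕ j) (m≤m+n a _) (+-monoʳ-< a (toℕ<n j))

  preimage : Fin N → Fin N
  preimage j = proj₁ (hit j)

  preimage-spec : ∀ j → h (preimage j) ≡ a + toℕ j
  preimage-spec j = proj₂ (hit j)

  preimage-surjective : ∀ x → ∃ λ j → preimage j ≡ x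
  preimage-surjective = injective⇒surjective preimage λ {j} {j′} eq →
    toℕ-injective (+-cancelˡ-≡ a _ _ (trans (sym (preimage-spec j)) (trans (cong h eq) (preimage-spec j′))))

  onto⇒into : Into a (a + N) h
  onto⇒into x with preimage-surjective x
  ... | j , refl rewrite preimage-spec j = m≤m+n a (toℕ j) , +-monoʳ-< a (toℕ<n j)

  onto⇒injective : Injective _≡_ _≡_ h
  onto⇒injective {x} {y} eq with preimage-surjective x | preimage-surjective y
  ... | j , refl | j′ , refl = cong preimage (toℕ-injective (+-cancelˡ-≡ a _ _
    (trans (sym (preimage-spec j)) (trans eq (preimage-spec j′)))))

∑-split : ∀ m n (g : Fin (m + n) → ℕ) →
  ∑[ u < m + n ] g u ≡ ∑[ i < m ] g (i ↑ˡ n) + ∑[ j < n ] g (m ↑ʳ j)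
∑-split zero    n g = refl
∑-split (suc m) n g = trans (cong (g Fin.zero +_) (∑-split m n (g ∘ Fin.suc))) (sym (+-assoc (g Fin.zero) _ _))

labelSum : (G : Graph) → (Elem G → ℕ) → ℕ
labelSum G f = ∑[ v < p G ] f (inj₁ v) + ∑[ e < q G ] f (inj₂ e)

module Enumerated (G : Graph) (f : Elem G → ℕ) where

  enumerated : Fin (p G + q G) → ℕ
  enumerated u = f (splitAt (p G) u)

  enumerated-join : ∀ x → enumerated (join (p G) (q G) x) ≡ f x
  enumerated-join x = cong f (splitAt-join (p G) (q G) x)

  enumerated-sum : ∑[ u < p G + q G ] enumerated u ≡ labelSum G f
  enumerated-sum = trans (∑-split (p G) (q G) enumerated)
    (cong₂ _+_ (sum-cong-≗ {p G} (λ v → cong f (splitAt-↑ˡ (p G) v (q G))))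
               (sum-cong-≗ {q G} (λ e → cong f (splitAt-↑ʳ (p G) (q G) e))))

  enumerated-injective : (∀ x y → f x ≡ f y → x ≡ y) → Injective _≡_ _≡_ enumerated
  enumerated-injective f-inj {u} {u′} eq =
    trans (sym (join-splitAt (p G) (q G) u))
      (trans (cong (join (p G) (q G)) (f-inj _ _ eq)) (join-splitAt (p G) (q G) u′))

superGraceful-sum : ∀ k (G : Graph) (f : Elem G → ℕ) → IsSuperGraceful k G f →
  2 * labelSum G f + (p G + q G) ≡ (p G + q G) * (2 * k + (p G + q G))
superGraceful-sum k G f (f-inj , f-into , _ , _) =
  trans (cong (λ s → 2 * s + (p G + q G)) (sym enumerated-sum))
        (InjectiveIntoInterval.gauss-sum enumerated (f-into ∘ splitAt (p G)) (enumerated-injective f-inj))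
  where open Enumerated G f

-- To build a k-super graceful labeling it suffices to cover [k, k + p + q)
-- and satisfy the edge condition: bijectivity and the range follow by counting.
covering⇒superGraceful : ∀ k (G : Graph) (f : Elem G → ℕ) →
  Onto k (k + (p G + q G)) f →
  (∀ e → f (inj₂ e) ≡ ∣ f (inj₁ (src G e)) - f (inj₁ (tgt G e)) ∣) →
  IsSuperGraceful k G f
covering⇒superGraceful k G f f-onto f-edge = f-inj , f-into , f-onto , f-edge
  where
    open Enumerated G f
    enumerated-onto : Onto k (k + (p G + q G)) enumerated
    enumerated-onto = onto-∘ (join (p G) (q G)) (onto-≗ (λ x → sym (enumerated-join x)) f-onto)
    open CoveringInterval enumerated enumerated-onto
    f-into : Into k (k + (p G + q G)) f
    f-into x = subst (λ l → k ≤ l × l < k + (p G + q G)) (enumerated-join x) (onto⇒into (join (p G) (q G) x))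
    f-inj : ∀ x y → f x ≡ f y → x ≡ y
    f-inj x y eq = trans (sym (splitAt-join (p G) (q G) x))
      (trans (cong (splitAt (p G)) (onto⇒injective (trans (enumerated-join x) (trans eq (sym (enumerated-join y))))))
        (splitAt-join (p G) (q G) y))

edgeOf : ∀ n → Fin (n + n) → Fin n
edgeOf n v = [ id , id ]′ (splitAt n v)

edgeOf-↑ˡ : ∀ n (i : Fin n) → edgeOf n (i ↑ˡ n) ≡ i
edgeOf-↑ˡ n i = cong [ id , id ]′ (splitAt-↑ˡ n i n)

edgeOf-↑ʳ : ∀ n (i : Fin n) → edgeOf n (n ↑ʳ i) ≡ i
edgeOf-↑ʳ n i = cong [ id , id ]′ (splitAt-↑ʳ n n i)

endpoint : ∀ n (v : Fin (n + n)) → v ≡ edgeOf n v ↑ˡ n ⊎ v ≡ n ↑ʳ edgeOf n v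
endpoint n v with splitAt n v in eq
... | inj₁ _ = inj₁ (trans (sym (join-splitAt n n v)) (cong (join n n) eq))
... | inj₂ _ = inj₂ (trans (sym (join-splitAt n n v)) (cong (join n n) eq))

sameEdge : ∀ n (v w : Fin (n + n)) → edgeOf n v ≡ edgeOf n w → v ≡ w ⊎ Adjacent (nK₂ n) v w
sameEdge n v w eq with endpoint n v | endpoint n w
... | inj₁ v≡ | inj₁ w≡ = inj₁ (trans v≡ (trans (cong (_↑ˡ n) eq) (sym w≡)))
... | inj₁ v≡ | inj₂ w≡ = inj₂ (edgeOf n v , inj₁ (sym v≡ , trans (cong (n ↑ʳ_) eq) (sym w≡)))
... | inj₂ v≡ | inj₁ w≡ = inj₂ (edgeOf n w , inj₂ (sym w≡ , trans (cong (n ↑ʳ_) (sym eq)) (sym v≡)))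
... | inj₂ v≡ | inj₂ w≡ = inj₁ (trans v≡ (trans (cong (n ↑ʳ_) eq) (sym w≡)))

-- n distinct pairwise non-adjacent vertices of nK₂ lie on n distinct edges,
-- so every edge has an endpoint among them.
independent-transversal : ∀ n (S : Fin n → Fin (n + n)) →
  (∀ i j → S i ≡ S j → i ≡ j) → (∀ i j → i ≢ j → ¬ Adjacent (nK₂ n) (S i) (S j)) →
  ∀ e → ∃ λ i → edgeOf n (S i) ≡ e
independent-transversal n S S-inj S-indep = injective⇒surjective (edgeOf n ∘ S) edges-distinct
  where
    edges-distinct : Injective _≡_ _≡_ (edgeOf n ∘ S)
    edges-distinct {i} {j} eq with i Fin.≟ j
    ... | yes i≡j = i≡j
    ... | no i≢j with sameEdge n (S i) (S j) eq
    ...   | inj₁ Si≡Sj   = S-inj i j Si≡Sj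
    ...   | inj₂ adjacent = ⊥-elim (S-indep i j i≢j adjacent)

source≢target : ∀ n (e i : Fin n) → e ↑ˡ n ≢ n ↑ʳ i
source≢target n e i eq with trans (sym (splitAt-↑ˡ n e n)) (trans (cong (splitAt n) eq) (splitAt-↑ʳ n n i))
... | ()

targets-independent : ∀ n (i j : Fin n) → ¬ Adjacent (nK₂ n) (n ↑ʳ i) (n ↑ʳ j)
targets-independent n i j (e , inj₁ (e≡i , _)) = source≢target n e i e≡i
targets-independent n i j (e , inj₂ (e≡j , _)) = source≢target n e j e≡j

sum-plus-distance : ∀ a b → a + b + ∣ a - b ∣ ≡ (a ⊔ b) + (a ⊔ b)
sum-plus-distance a b with ≤-total a b
... | inj₁ a≤b rewrite m≤n⇒∣m-n∣≡n∸m a≤b | m≤n⇒m⊔n≡n a≤b = small+large a≤b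
  where
    small+large : ∀ {x y} → x ≤ y → x + y + (y ∸ x) ≡ y + y
    small+large {x} {y} x≤y = trans (regroup x y (y ∸ x)) (cong (y +_) (m+[n∸m]≡n x≤y))
      where
        regroup : ∀ x y d → x + y + d ≡ y + (x + d)
        regroup = solve-∀
... | inj₂ b≤a rewrite m≤n⇒∣n-m∣≡n∸m b≤a | m≥n⇒m⊔n≡m b≤a = trans (+-assoc a b _) (cong (a +_) (m+[n∸m]≡n b≤a))

module EdgeMaxima {n : ℕ} (f : Elem (nK₂ n) → ℕ) where

  top : Fin n → ℕ
  top e = f (inj₁ (e ↑ˡ n)) ⊔ f (inj₁ (n ↑ʳ e))

  top-attained : ∀ e → ∃ λ v → f (inj₁ v) ≡ top e × edgeOf n v ≡ e
  top-attained e with ⊔-sel (f (inj₁ (e ↑ˡ n))) (f (inj₁ (n ↑ʳ e)))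
  ... | inj₁ top≡ = e ↑ˡ n , sym top≡ , edgeOf-↑ˡ n e
  ... | inj₂ top≡ = n ↑ʳ e , sym top≡ , edgeOf-↑ʳ n e

  -- Distinct edges have disjoint endpoints, so their maxima differ.
  top-injective : (∀ x y → f x ≡ f y → x ≡ y) → Injective _≡_ _≡_ top
  top-injective f-inj {e} {e′} eq with top-attained e | top-attained e′
  ... | v , fv≡ , refl | v′ , fv′≡ , refl =
    cong (edgeOf n) (inj₁-injective (f-inj _ _ (trans fv≡ (trans eq (sym fv′≡)))))

  labelSum-top : (∀ e → f (inj₂ e) ≡ ∣ f (inj₁ (e ↑ˡ n)) - f (inj₁ (n ↑ʳ e)) ∣) →
    labelSum (nK₂ n) f ≡ ∑[ e < n ] top e + ∑[ e < n ] top e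
  labelSum-top f-edge = begin
    ∑[ v < n + n ] f (inj₁ v) + ∑[ e < n ] f (inj₂ e)   ≡⟨ cong (_+ ∑[ e < n ] c e) (∑-split n n (f ∘ inj₁)) ⟩
    (∑[ e < n ] a e + ∑[ e < n ] b e) + ∑[ e < n ] c e   ≡⟨ cong (_+ ∑[ e < n ] c e) (∑-distrib-+ a b) ⟨
    ∑[ e < n ] (a e + b e) + ∑[ e < n ] c e             ≡⟨ ∑-distrib-+ (λ e → a e + b e) c ⟨
    ∑[ e < n ] (a e + b e + c e)                         ≡⟨ sum-cong-≗ {n} (λ e → trans (cong (a e + b e +_) (f-edge e)) (sum-plus-distance (a e) (b e))) ⟩
    ∑[ e < n ] (top e + top e)                           ≡⟨ ∑-distrib-+ top top ⟩
    ∑[ e < n ] top e + ∑[ e < n ] top e                 ∎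
    where
      open ≡-Reasoning
      a b c : Fin n → ℕ
      a e = f (inj₁ (e ↑ˡ n))
      b e = f (inj₁ (n ↑ʳ e))
      c e = f (inj₂ e)

-- The arithmetic: with X the sum of the maxima, the two Gauss sums force
-- n(n + 1) = 2kn.
counting-equation : ∀ n k X → 1 ≤ n →
  2 * (X + X) + ((n + n) + n) ≡ ((n + n) + n) * (2 * k + ((n + n) + n)) →
  2 * X + n ≡ n * (2 * (k + 2 * n) + n) →
  n ≡ 2 * k ∸ 1
counting-equation n k X 1≤n all-labels top-labels =
  trans (sym (m+n∸n≡m n 1)) (cong (_∸ 1) (*-cancelˡ-≡ (n + 1) (2 * k) n {{>-nonZero 1≤n}} n[n+1]≡n[2k]))
  where
    open ≡-Reasoning
    n[n+1]≡n[2k] : n * (n + 1) ≡ n * (2 * k)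
    n[n+1]≡n[2k] = +-cancelʳ-≡ (n * (4 * k + 9 * n)) _ _ (begin
      n * (n + 1) + n * (4 * k + 9 * n)        ≡⟨ lhs n k ⟩
      2 * (n * (2 * (k + 2 * n) + n)) + n      ≡⟨ cong (λ z → 2 * z + n) top-labels ⟨
      2 * (2 * X + n) + n                      ≡⟨ middle n X ⟩
      2 * (X + X) + ((n + n) + n)              ≡⟨ all-labels ⟩
      ((n + n) + n) * (2 * k + ((n + n) + n))  ≡⟨ rhs n k ⟩
      n * (2 * k) + n * (4 * k + 9 * n)        ∎)
      where
        lhs : ∀ n k → n * (n + 1) + n * (4 * k + 9 * n) ≡ 2 * (n * (2 * (k + 2 * n) + n)) + n
        lhs = solve-∀
        middle : ∀ n X → 2 * (2 * X + n) + n ≡ 2 * (X + X) + ((n + n) + n)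
        middle = solve-∀
        rhs : ∀ n k → ((n + n) + n) * (2 * k + ((n + n) + n)) ≡ n * (2 * k) + n * (4 * k + 9 * n)
        rhs = solve-∀

necessity : ∀ n k → 1 ≤ n →
  (∃ λ (f : Elem (nK₂ n) → ℕ) →
     IsSuperGraceful k (nK₂ n) f × LargestOnIndependent (nK₂ n) f n (k + 2 * n) (k + 3 * n)) →
  n ≡ 2 * k ∸ 1
necessity n k 1≤n (f , sg@(f-inj , f-into , _ , f-edge) , (S , S-inj , S-indep , S-into , _)) =
  counting-equation n k (∑[ e < n ] top e) 1≤n
    (trans (cong (λ s → 2 * s + ((n + n) + n)) (sym (labelSum-top f-edge))) (superGraceful-sum k (nK₂ n) f sg))
    (InjectiveIntoInterval.gauss-sum top top-into (top-injective f-inj))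
  where
    open EdgeMaxima f
    -- every edge carries a vertex of S, whose label is at least k + 2n
    top-large : ∀ e → k + 2 * n ≤ top e
    top-large e with independent-transversal n S S-inj S-indep e
    ... | i , refl with endpoint n (S i)
    ...   | inj₁ Si≡ = ≤-trans (proj₁ (S-into i)) (≤-trans (≤-reflexive (cong (f ∘ inj₁) Si≡)) (m≤m⊔n _ _))
    ...   | inj₂ Si≡ = ≤-trans (proj₁ (S-into i)) (≤-trans (≤-reflexive (cong (f ∘ inj₁) Si≡)) (m≤n⊔m _ _))
    top-into : Into (k + 2 * n) (k + 2 * n + n) top
    top-into e = top-large e , subst (top e <_) (bound k n) (⊔-lub (proj₂ (f-into _)) (proj₂ (f-into _)))
      where
        bound : ∀ k n → k + ((n + n) + n) ≡ k + 2 * n + n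
        bound = solve-∀

data Halves : ℕ → Set where
  twice   : ∀ t → Halves (t + t)
  twice+1 : ∀ t → Halves (suc (t + t))

halve : ∀ d → Halves d
halve zero = twice 0
halve (suc zero) = twice+1 0
halve (suc (suc d)) with halve d
... | twice t   = subst Halves (cong suc (+-suc t t)) (twice (suc t))
... | twice+1 t = subst Halves (cong (λ x → suc (suc x)) (+-suc t t)) (twice+1 (suc t))

doubled : ∀ {N} → Fin N → ℕ
doubled i = toℕ i + toℕ i

doubled+1 : ∀ {N} → Fin N → ℕ
doubled+1 i = suc (doubled i)

interleave : ∀ K → Fin (suc K + K) → ℕ
interleave K = doubled {suc K} ++ doubled+1 {K}

interleave-onto : ∀ K → Onto 0 (suc K + K) (interleave K)
interleave-onto K d _ d<n with halve d
... | twice t = fromℕ< t<1+K ↑ˡ K ,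
      trans (lookup-++ˡ doubled doubled+1 (fromℕ< t<1+K)) (cong (λ x → x + x) (toℕ-fromℕ< t<1+K))
  where
    t<1+K : t < suc K
    t<1+K with t <? suc K
    ... | yes t<1+K = t<1+K
    ... | no t≮1+K = ⊥-elim (<⇒≱ d<n (+-mono-≤ (≮⇒≥ t≮1+K) (≤-trans (n≤1+n K) (≮⇒≥ t≮1+K))))
... | twice+1 t = suc K ↑ʳ fromℕ< t<K ,
      trans (lookup-++ʳ (doubled {suc K}) doubled+1 (fromℕ< t<K)) (cong (λ x → suc (x + x)) (toℕ-fromℕ< t<K))
  where
    t<K : t < K
    t<K with t <? K
    ... | yes t<K = t<K
    ... | no t≮K = ⊥-elim (<⇒≱ d<n (s≤s (+-mono-≤ (≮⇒≥ t≮K) (≮⇒≥ t≮K))))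

-- Edges are long (i ↑ˡ K, i ≤ K) or short (suc K ↑ʳ j, j < K).  With k = K + 1
-- the label blocks, in increasing order, are
--   short edges [k, edgeMid),  long edges [edgeMid, edgeTop) = [2k - 1, 3k - 1),
--   long sources [edgeTop, sourceMid),  short sources [sourceMid, targetBottom),
--   targets [targetBottom, targetBottom + n) = [k + 2n, k + 3n),
-- and each target is source + edge: 5K + 3 + 2i resp. 5K + 4 + 2j.
module Construction (K : ℕ) where

  n : ℕ
  n = suc K + K

  edgeMid edgeTop sourceMid targetBottom : ℕ
  edgeMid      = suc K + K
  edgeTop      = edgeMid + suc K
  sourceMid    = edgeTop + suc K
  targetBottom = sourceMid + K

  longEdge longSource : Fin (suc K) → ℕ
  longEdge i   = edgeMid + toℕ i
  longSource i = edgeTop + toℕ i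

  shortEdge shortSource : Fin K → ℕ
  shortEdge j   = suc K + toℕ j
  shortSource j = sourceMid + toℕ j

  edgeLabel sourceLabel targetLabel : Fin n → ℕ
  edgeLabel     = longEdge ++ shortEdge
  sourceLabel   = longSource ++ shortSource
  targetLabel e = sourceLabel e + edgeLabel e

  label : Elem (nK₂ n) → ℕ
  label (inj₁ v) = (sourceLabel ++ targetLabel) v
  label (inj₂ e) = edgeLabel e

  2k-1≡n : 2 * suc K ∸ 1 ≡ n
  2k-1≡n = lemma K
    where
      lemma : ∀ K → K + (suc K + 0) ≡ suc K + K
      lemma = solve-∀

  label-edge : ∀ e → label (inj₂ e) ≡ ∣ label (inj₁ (e ↑ˡ n)) - label (inj₁ (n ↑ʳ e)) ∣
  label-edge e rewrite lookup-++ˡ sourceLabel targetLabel e | lookup-++ʳ sourceLabel targetLabel e =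
    sym (∣m-m+n∣≡n (sourceLabel e) (edgeLabel e))

  edgeLabel-onto : Onto (suc K) edgeTop edgeLabel
  edgeLabel-onto = onto-∪ (++-onto-ʳ longEdge (onto-shift (suc K) toℕ-onto))
                          (++-onto-ˡ shortEdge (onto-shift edgeMid toℕ-onto))

  sourceLabel-onto : Onto edgeTop targetBottom sourceLabel
  sourceLabel-onto = onto-∪ (++-onto-ˡ shortSource (onto-shift edgeTop toℕ-onto))
                            (++-onto-ʳ longSource (onto-shift sourceMid toℕ-onto))

  targetLabel-interleaved : ∀ e → targetBottom + interleave K e ≡ targetLabel e
  targetLabel-interleaved e with splitAt (suc K) e
  ... | inj₁ i = long K (toℕ i)
    where
      long : ∀ K t → ((((suc K + K) + suc K) + suc K) + K) + (t + t)
                   ≡ (((suc K + K) + suc K) + t) + ((suc K + K) + t)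
      long = solve-∀
  ... | inj₂ j = short K (toℕ j)
    where
      short : ∀ K t → ((((suc K + K) + suc K) + suc K) + K) + suc (t + t)
                    ≡ ((((suc K + K) + suc K) + suc K) + t) + (suc K + t)
      short = solve-∀

  targetLabel-onto : Onto targetBottom (targetBottom + n) targetLabel
  targetLabel-onto = onto-≗ targetLabel-interleaved (onto-shift targetBottom (interleave-onto K))

  label-onto : Onto (suc K) (targetBottom + n) label
  label-onto = onto-∪ (onto-∘ inj₂ edgeLabel-onto)
    (onto-∘ inj₁ (onto-∪ (++-onto-ˡ targetLabel sourceLabel-onto) (++-onto-ʳ sourceLabel targetLabel-onto)))

  label-superGraceful : IsSuperGraceful (suc K) (nK₂ n) label
  label-superGraceful = covering⇒superGraceful (suc K) (nK₂ n) label
    (subst (λ b → Onto (suc K) b label) (sym (total K)) label-onto) label-edge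
    where
      total : ∀ K → suc K + ((suc K + K + (suc K + K)) + (suc K + K))
                  ≡ ((((suc K + K) + suc K) + suc K) + K) + (suc K + K)
      total = solve-∀

  target : Fin n → ℕ
  target i = label (inj₁ (n ↑ʳ i))

  target-onto : Onto targetBottom (targetBottom + n) target
  target-onto = onto-≗ (λ i → sym (lookup-++ʳ sourceLabel targetLabel i)) targetLabel-onto

  targets-largest : LargestOnIndependent (nK₂ n) label n (suc K + 2 * n) (suc K + 3 * n)
  targets-largest = (n ↑ʳ_) , ↑ʳ-injective n , (λ i j _ → targets-independent n i j) ,
    subst₂ (λ a b → Into a b target) (lower K) (upper K) (CoveringInterval.onto⇒into target target-onto) ,
    subst₂ (λ a b → Onto a b target) (lower K) (upper K) target-onto
    where
      lower : ∀ K → (((suc K + K) + suc K) + suc K) + K ≡ suc K + 2 * (suc K + K)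
      lower = solve-∀
      upper : ∀ K → ((((suc K + K) + suc K) + suc K) + K) + (suc K + K) ≡ suc K + 3 * (suc K + K)
      upper = solve-∀

  edgeTop≡3k-1 : suc (3 * suc K ∸ 2) ≡ edgeTop
  edgeTop≡3k-1 = cong (λ x → suc (x ∸ 2)) (three-k K)
    where
      three-k : ∀ K → 3 * suc K ≡ suc ((suc K + K) + suc K)
      three-k = solve-∀

  edgeLabel-into : Into (suc K) edgeTop edgeLabel
  edgeLabel-into = subst (λ b → Into (suc K) b edgeLabel) (sym (edgeTop≡k+n K))
    (CoveringInterval.onto⇒into edgeLabel (subst (λ b → Onto (suc K) b edgeLabel) (edgeTop≡k+n K) edgeLabel-onto))
    where
      edgeTop≡k+n : ∀ K → (suc K + K) + suc K ≡ suc K + (suc K + K)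
      edgeTop≡k+n = solve-∀

  edgeLabels : (∀ e → suc K ≤ edgeLabel e × edgeLabel e ≤ 3 * suc K ∸ 2)
             × (∀ m → suc K ≤ m → m ≤ 3 * suc K ∸ 2 → ∃ λ e → edgeLabel e ≡ m)
  edgeLabels =
    (λ e → proj₁ (edgeLabel-into e) ,
           m<1+n⇒m≤n (subst (edgeLabel e <_) (sym edgeTop≡3k-1) (proj₂ (edgeLabel-into e)))) ,
    (λ m k≤m m≤3k-2 → edgeLabel-onto m k≤m (subst (m <_) edgeTop≡3k-1 (s≤s m≤3k-2)))

theorem3p14 : (n k : ℕ) → 1 ≤ n → 1 ≤ k →
    ((∃ λ (f : Elem (nK₂ n) → ℕ) →
        IsSuperGraceful k (nK₂ n) f
        × LargestOnIndependent (nK₂ n) f n (k + 2 * n) (k + 3 * n))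
      → n ≡ 2 * k ∸ 1)
    × (n ≡ 2 * k ∸ 1 →
       ∃ λ (f : Elem (nK₂ n) → ℕ) →
         IsSuperGraceful k (nK₂ n) f
         × LargestOnIndependent (nK₂ n) f n (k + 2 * n) (k + 3 * n))
    × (∃ λ (f : Elem (nK₂ (2 * k ∸ 1)) → ℕ) →
         IsSuperGraceful k (nK₂ (2 * k ∸ 1)) f
         × (∀ (e : Fin (2 * k ∸ 1)) → k ≤ f (inj₂ e) × f (inj₂ e) ≤ 3 * k ∸ 2)
         × (∀ m → k ≤ m → m ≤ 3 * k ∸ 2 → ∃ λ (e : Fin (2 * k ∸ 1)) → f (inj₂ e) ≡ m))
theorem3p14 n zero    _   ()
theorem3p14 n (suc K) 1≤n _ =
  necessity n (suc K) 1≤n ,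
  (λ n≡2k-1 → subst WithLargestIndependent (sym (trans n≡2k-1 2k-1≡n))
                    (label , label-superGraceful , targets-largest)) ,
  subst WithEdgeLabels (sym 2k-1≡n) (label , label-superGraceful , edgeLabels)
  where
    open Construction K using (label; label-superGraceful; targets-largest; edgeLabels; 2k-1≡n)
    WithLargestIndependent WithEdgeLabels : ℕ → Set
    WithLargestIndependent m = ∃ λ (f : Elem (nK₂ m) → ℕ) →
      IsSuperGraceful (suc K) (nK₂ m) f × LargestOnIndependent (nK₂ m) f m (suc K + 2 * m) (suc K + 3 * m)
    WithEdgeLabels m = ∃ λ (f : Elem (nK₂ m) → ℕ) →
      IsSuperGraceful (suc K) (nK₂ m) f
      × (∀ (e : Fin m) → suc K ≤ f (inj₂ e) × f (inj₂ e) ≤ 3 * suc K ∸ 2)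
      × (∀ x → suc K ≤ x → x ≤ 3 * suc K ∸ 2 → ∃ λ (e : Fin m) → f (inj₂ e) ≡ x)
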